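{- Let $q\ge 27$ be a prime power with $q\equiv 3\pmod 4$, let $\xi$ be a primitive element of $F_q$, $P=(0,1,0)$, $Z=(1,0,-1)$. For an integer $\overline{J}$ let $\mathcal{Q}_{\overline{J}}=\{P,Z\}\cup\{(1,\xi^d,\xi^{2d}): d=0,1,\dots,\overline{J}\}$, and let $\overline{J}_q$ be the smallest integer $\overline{J}$ such that all points $(1,a,b)$ with $a\in F_q\setminus\{0\}$, $b\in F_q$, $b\ne a^2$, and all points $(0,1,b)$ with $b\in F_q\setminus\{0\}$ lie on bisecants of $\mathcal{Q}_{\overline{J}}$. Assume $\overline{J}_q\le (q-3)/2$ and let $J$ be an integer with $\max\{\overline{J}_q,(q-3)/4\}\le J\le (q-3)/2$. Then $\mathcal{E}_J=\{(1,\xi^d,\xi^{2d}): d=0,\dots,J\}\cup\{P,Z,(1,0,-\xi^{2J})\}$ is a complete arc in $PG(2,q)$.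
   Context: Points of $PG(2,q)$ are in homogeneous coordinates $(x_0,x_1,x_2)$. A bisecant of a point set is a line through two of its distinct points. An arc is a set of points no three collinear; it is complete if it is not contained in a larger arc. -}

module Defs where

open import Level using (0ℓ)
open import Data.Nat as ℕ using (ℕ; zero; suc)
open import Data.Product using (Σ; ∃; _×_; _,_)
open import Data.List using (List; []; _∷_; map; upTo; length)
open import Data.List.Relation.Unary.Any using (Any)
open import Data.List.Membership.Propositional using (_∈_)
open import Data.List.Relation.Unary.Unique.Propositional using (Unique)
open import Relation.Binary.PropositionalEquality using (_≡_; _≢_)
open import Relation.Binary.Definitions using (DecidableEquality)
open import Relation.Nullary using (¬_)
open import Algebra.Structures using (IsCommutativeRing)

record FiniteField : Set₁ where
  infixl 7 _*_
  infixl 6 _+_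
  field
    Carrier : Set
    _+_ _*_ : Carrier → Carrier → Carrier
    -_      : Carrier → Carrier
    0# 1#   : Carrier
    isCommutativeRing : IsCommutativeRing _≡_ _+_ _*_ -_ 0# 1#
    0≢1     : 0# ≢ 1#
    inverse : ∀ x → x ≢ 0# → Σ Carrier (λ y → x * y ≡ 1#)
    _≟_     : DecidableEquality Carrier
    elements : List Carrier
    complete : ∀ x → x ∈ elements
    unique   : Unique elements

  order : ℕ
  order = length elements

  _^_ : Carrier → ℕ → Carrier
  x ^ zero  = 1#
  x ^ suc n = x * (x ^ n)

  IsPrimitive : Carrier → Set
  IsPrimitive ξ = ∀ x → x ≢ 0# → Σ ℕ (λ k → ξ ^ k ≡ x)

module PG2 (F : FiniteField) where
  open FiniteField F

  Vec3 : Set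
  Vec3 = Carrier × Carrier × Carrier

  -- a vector represents a point of PG(2,q) iff it is nonzero
  NonZero3 : Vec3 → Set
  NonZero3 (a , b , c) = ¬ (a ≡ 0# × b ≡ 0# × c ≡ 0#)

  -- u and v represent the same point of PG(2,q)
  _∼_ : Vec3 → Vec3 → Set
  (a , b , c) ∼ (a' , b' , c') =
    Σ Carrier (λ t → t ≢ 0# × a ≡ t * a' × b ≡ t * b' × c ≡ t * c')

  det : Vec3 → Vec3 → Vec3 → Carrier
  det (a₀ , a₁ , a₂) (b₀ , b₁ , b₂) (c₀ , c₁ , c₂) =
      a₀ * (b₁ * c₂ + - (b₂ * c₁))
    + - (a₁ * (b₀ * c₂ + - (b₂ * c₀)))
    + a₂ * (b₀ * c₁ + - (b₁ * c₀))

  Collinear : Vec3 → Vec3 → Vec3 → Set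
  Collinear u v w = det u v w ≡ 0#

  -- point sets are given by lists of representatives
  _∈P_ : Vec3 → List Vec3 → Set
  v ∈P S = Any (λ w → v ∼ w) S

  OnBisecant : Vec3 → List Vec3 → Set
  OnBisecant X S = Σ Vec3 (λ A → Σ Vec3 (λ B →
    A ∈P S × B ∈P S × ¬ (A ∼ B) × Collinear A B X))

  IsArc : List Vec3 → Set
  IsArc S = ∀ A B C → A ∈P S → B ∈P S → C ∈P S →
    ¬ (A ∼ B) → ¬ (A ∼ C) → ¬ (B ∼ C) → ¬ Collinear A B C

  IsCompleteArc : List Vec3 → Set
  IsCompleteArc S = IsArc S ×
    (∀ X → NonZero3 X → ¬ (X ∈P S) → ¬ IsArc (X ∷ S))

  module Construction (ξ : Carrier) where
    P Z : Vec3
    P = (0# , 1# , 0#)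
    Z = (1# , 0# , - 1#)

    conicPts : ℕ → List Vec3
    conicPts J = map (λ d → (1# , ξ ^ d , ξ ^ (2 ℕ.* d))) (upTo (suc J))

    𝒬 : ℕ → List Vec3
    𝒬 J̄ = P ∷ Z ∷ conicPts J̄

    ℰ : ℕ → List Vec3
    ℰ J = P ∷ Z ∷ (1# , 0# , - (ξ ^ (2 ℕ.* J))) ∷ conicPts J

    Covers : ℕ → Set
    Covers J̄ =
      (∀ a b → a ≢ 0# → b ≢ a * a → OnBisecant (1# , a , b) (𝒬 J̄)) ×
      (∀ b → b ≢ 0# → OnBisecant (0# , 1# , b) (𝒬 J̄))

    IsJq : ℕ → Set
    IsJq J̄ = Covers J̄ × (∀ J' → Covers J' → J̄ ℕ.≤ J')

module Submission where

-- Write q = 2h + 1 with h odd.  A primitive element ξ has order N = 2h, so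
-- ξ^h = -1 and, h being odd, -1 is not a square.  Put E_t = (1, 0, -ξ^(2t)) and
-- C_d = (1, ξ^d, ξ^(2d)); then Z = E₀ and ℰ_J = {P, E₀, E_J} ∪ {C_d : d ≤ J}.
--
-- Up to the order of the points, three distinct points of ℰ_J form one of
-- six configurations (PEE, PEC, PCC, EEC, ECC, CCC).  Each determinant factors
-- into differences ξ^a - ξ^b with a ≠ b ≤ 2J < N, or is -(x² + z²) with z ≠ 0,
-- hence is nonzero.  A point off ℰ_J lies on the line Z E_J (if x₁ = 0), or is
-- covered by a bisecant of 𝒬_J̄ ⊆ ℰ_J (if it is off the conic), or is a conic
-- point C_k with J < k < N.  Such a C_k lies on the chord E_J C_(2J-k), on the
-- line P C_(k-h) (as ξ^(2h) = 1), or on the chord Z C_(N-k), and J ≥ (q - 3)/4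
-- makes the partner index at most J.

open import Defs
open import Data.Nat using (ℕ; _≤_; _∸_; _/_; _%_)
open import Relation.Binary.PropositionalEquality using (_≡_)

open import Level using (0ℓ)
open import Algebra.Bundles using (CommutativeRing)
open import Algebra.Solver.Ring.AlmostCommutativeRing using (fromCommutativeRing; _-Raw-AlmostCommutative⟶_)
import Algebra.Properties.Ring as RingProperties
import Algebra.Properties.Semiring.Mult.TCOptimised as Multiples
open import Data.Maybe using (Maybe; nothing; just)
open import Relation.Nullary using (yes; no; ¬_)
open import Relation.Binary.PropositionalEquality using (refl; sym; trans; cong; cong₂; subst; _≢_; module ≡-Reasoning)
open import Data.Product using (∃-syntax; _×_; _,_; proj₁; proj₂)
open import Data.Sum using (_⊎_; inj₁; inj₂)
open import Data.Empty using (⊥; ⊥-elim)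
open import Data.Unit using (⊤; tt)
open import Data.Nat as ℕ using (zero; suc; _<_; z≤n; s≤s)
open import Data.Integer as ℤ using (ℤ; -[1+_])
import Data.Integer.Properties as ℤP
import Data.Nat.Properties as ℕP
open import Data.Sign as Sign using (Sign)
open import Data.Nat.DivMod using (m≡m%n+[m/n]*n; m%n<n; m*n/n≡m)
open import Data.Nat.Divisibility using (_∣_; divides; m%n≡0⇒n∣m; m∣m*n; ∣m+n∣m⇒∣n; ∣-trans; ∣1⇒≡1)
open import Relation.Binary.Definitions using (tri<; tri≈; tri>)
open import Data.List using (List; _∷_; lookup)
open import Data.List.Relation.Unary.Any using (Any; here; there)
open import Data.List.Relation.Unary.AllPairs using (_∷_)
import Data.List.Relation.Unary.All as All
import Data.List.Relation.Unary.Any as Any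
open import Data.List.Relation.Unary.Unique.Propositional using (Unique)
import Data.List.Membership.Propositional as Mem
import Data.List.Membership.Propositional.Properties as MemP
import Data.List.Membership.Setoid.Properties as MemSP
open import Data.Fin as Fin using (Fin)
import Data.Fin.Properties as FinP
import Relation.Binary.PropositionalEquality as ≡

module Arithmetic where
  open import Data.Nat using (_+_; _*_)
  open import Data.Nat.Tactic.RingSolver using (solve-∀)

  2*-as-sum : ∀ n → 2 * n ≡ n + n
  2*-as-sum n = cong (n +_) (ℕP.+-identityʳ n)

  distinct-sum<double : ∀ {d e J} → d < e → e ≤ J → d + e < 2 * J
  distinct-sum<double {d} {e} {J} d<e e≤J =
    ℕP.<-≤-trans (ℕP.+-monoˡ-< e d<e) (ℕP.≤-trans (ℕP.+-mono-≤ e≤J e≤J) (ℕP.≤-reflexive (sym (2*-as-sum J))))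

  conic-partner : ∀ {J h k} → h ≤ suc (2 * J) → J < k → k < 2 * h →
                  ∃[ d ] d ≤ J × (d + k ≡ 2 * J ⊎ d + h ≡ k ⊎ d + k ≡ 2 * h)
  conic-partner {J} {h} {k} h≤2J+1 J<k k<2h with k ℕP.≤? 2 * J | k ℕP.≤? J + h
  ... | yes k≤2J | _ = 2 * J ∸ k , d≤J , inj₁ (ℕP.m∸n+n≡m k≤2J)
    where
    d≤J : 2 * J ∸ k ≤ J
    d≤J = ℕP.≤-trans (ℕP.∸-monoʳ-≤ (2 * J) (ℕP.<⇒≤ J<k))
                     (ℕP.≤-reflexive (trans (cong (_∸ J) (2*-as-sum J)) (ℕP.m+n∸n≡m J J)))
  ... | no k≰2J | yes k≤J+h = k ∸ h , d≤J , inj₂ (inj₁ (ℕP.m∸n+n≡m h≤k))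
    where
    h≤k : h ≤ k
    h≤k = ℕP.≤-trans h≤2J+1 (ℕP.≰⇒> k≰2J)
    d≤J : k ∸ h ≤ J
    d≤J = ℕP.≤-trans (ℕP.∸-monoˡ-≤ h k≤J+h) (ℕP.≤-reflexive (ℕP.m+n∸n≡m J h))
  ... | no _ | no k≰J+h = d , d≤J , inj₂ (inj₂ d+k≡2h)
    where
    d = 2 * h ∸ k
    d+k≡2h : d + k ≡ 2 * h
    d+k≡2h = ℕP.m∸n+n≡m (ℕP.<⇒≤ k<2h)
    -- d + (J + h) < d + k = h + h ≤ 2J + 1 + h
    bound : d + (J + h) < suc (2 * J) + h
    bound = ℕP.<-≤-trans (ℕP.+-monoʳ-< d (ℕP.≰⇒> k≰J+h))
              (ℕP.≤-trans (ℕP.≤-reflexive (trans d+k≡2h (2*-as-sum h))) (ℕP.+-monoˡ-≤ h h≤2J+1))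
    d≤J : d ≤ J
    d≤J = ℕP.+-cancelʳ-≤ (J + h) d J (subst (d + (J + h) ≤_) (rearrange J h) (ℕP.≤-pred bound))
      where
      rearrange : ∀ J h → 2 * J + h ≡ J + (J + h)
      rearrange = solve-∀

  module ThreeModFour (q : ℕ) (q%4≡3 : q % 4 ≡ 3) where
    m h : ℕ
    m = q / 4
    h = suc (2 * m)

    q≡3+4m : q ≡ 3 + m * 4
    q≡3+4m = trans (m≡m%n+[m/n]*n q 4) (cong (_+ m * 4) q%4≡3)

    q≡2h+1 : q ≡ suc (2 * h)
    q≡2h+1 = trans q≡3+4m (regroup m)
      where
      regroup : ∀ m → 3 + m * 4 ≡ suc (2 * suc (2 * m))
      regroup = solve-∀

    quarter : (q ∸ 3) / 4 ≡ m
    quarter = trans (cong (λ n → (n ∸ 3) / 4) q≡3+4m) (m*n/n≡m m 4)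

    half : (q ∸ 3) / 2 ≡ 2 * m
    half = trans (cong (λ n → (n ∸ 3) / 2) (trans q≡3+4m (cong (3 +_) (regroup m)))) (m*n/n≡m (2 * m) 2)
      where
      regroup : ∀ m → m * 4 ≡ 2 * m * 2
      regroup = solve-∀

    h-odd : ¬ 2 ∣ h
    h-odd 2∣h with ∣1⇒≡1 (∣m+n∣m⇒∣n (subst (2 ∣_) (ℕP.+-comm 1 (2 * m)) 2∣h) (m∣m*n m))
    ... | ()

    m-positive : 4 ≤ q → 0 < m
    m-positive 4≤q with m | q≡3+4m
    ... | zero | q≡3 = ⊥-elim (ℕP.<-irrefl (sym q≡3) 4≤q)
    ... | suc _ | _ = s≤s z≤n

open Arithmetic

module TripleSorting {K : Set} (_≺_ : K → K → Set) (compare : ∀ a b → a ≺ b ⊎ a ≡ b ⊎ b ≺ a)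
                     (R : K → K → K → Set)
                     (swap₁₂ : ∀ {a b c} → R a b c → R b a c) (swap₂₃ : ∀ {a b c} → R a b c → R a c b)
                     (increasing : ∀ {a b c} → a ≺ b → b ≺ c → R a b c) where

  private
    first-smaller : ∀ {a b c} → a ≺ b → a ≢ c → b ≢ c → R a b c
    first-smaller {a} {b} {c} a≺b a≢c b≢c with compare b c
    ... | inj₁ b≺c = increasing a≺b b≺c
    ... | inj₂ (inj₁ b≡c) = ⊥-elim (b≢c b≡c)
    ... | inj₂ (inj₂ c≺b) with compare a c
    ...   | inj₁ a≺c = swap₂₃ (increasing a≺c c≺b)
    ...   | inj₂ (inj₁ a≡c) = ⊥-elim (a≢c a≡c)
    ...   | inj₂ (inj₂ c≺a) = swap₂₃ (swap₁₂ (increasing c≺a a≺b))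

  distinct-triples : ∀ a b c → a ≢ b → a ≢ c → b ≢ c → R a b c
  distinct-triples a b c a≢b a≢c b≢c with compare a b
  ... | inj₁ a≺b = first-smaller a≺b a≢c b≢c
  ... | inj₂ (inj₁ a≡b) = ⊥-elim (a≢b a≡b)
  ... | inj₂ (inj₂ b≺a) = swap₁₂ (first-smaller b≺a b≢c a≢c)

-- The ring solver of the standard library for an abstract finite field F, with
-- integer coefficients interpreted through the canonical morphism ℤ → F.
module FieldSolver (F : FiniteField) where
  open FiniteField F
  open ≡-Reasoning

  commutativeRing : CommutativeRing 0ℓ 0ℓ
  commutativeRing = record { isCommutativeRing = isCommutativeRing }

  open CommutativeRing commutativeRing public
    using (+-assoc; +-comm; +-identityˡ; +-identityʳ; *-assoc; *-comm; *-identityˡ; *-identityʳ;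
           -‿inverseˡ; -‿inverseʳ; zeroˡ; zeroʳ; ring; semiring)
  open RingProperties ring public using (-‿involutive; -‿+-comm; -0#≈0#; -‿distribˡ-*; -‿distribʳ-*)
  open Multiples semiring using (1+×; ×-homo-+; ×1-homo-*) renaming (_×_ to _·_)

  ⟦_⟧ℤ : ℤ → Carrier
  ⟦ ℤ.+ n ⟧ℤ = n · 1#
  ⟦ -[1+ n ] ⟧ℤ = - (suc n · 1#)

  ⟦⊖⟧ : ∀ m n → ⟦ m ℤ.⊖ n ⟧ℤ ≡ m · 1# + - (n · 1#)
  ⟦⊖⟧ zero zero = sym (trans (cong (0# +_) -0#≈0#) (+-identityˡ 0#))
  ⟦⊖⟧ zero (suc n) = sym (+-identityˡ _)
  ⟦⊖⟧ (suc m) zero = sym (trans (cong (suc m · 1# +_) -0#≈0#) (+-identityʳ _))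
  ⟦⊖⟧ (suc m) (suc n) = begin
    ⟦ suc m ℤ.⊖ suc n ⟧ℤ            ≡⟨ cong ⟦_⟧ℤ (ℤP.[1+m]⊖[1+n]≡m⊖n m n) ⟩
    ⟦ m ℤ.⊖ n ⟧ℤ                    ≡⟨ ⟦⊖⟧ m n ⟩
    a + - b                         ≡⟨ sym (+-identityˡ _) ⟩
    0# + (a + - b)                  ≡⟨ cong (_+ (a + - b)) (sym (-‿inverseʳ 1#)) ⟩
    (1# + - 1#) + (a + - b)         ≡⟨ +-assoc 1# (- 1#) (a + - b) ⟩
    1# + (- 1# + (a + - b))         ≡⟨ cong (1# +_) (+-comm (- 1#) (a + - b)) ⟩
    1# + ((a + - b) + - 1#)         ≡⟨ cong (1# +_) (+-assoc a (- b) (- 1#)) ⟩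
    1# + (a + (- b + - 1#))         ≡⟨ sym (+-assoc 1# a _) ⟩
    (1# + a) + (- b + - 1#)         ≡⟨ cong ((1# + a) +_) (trans (-‿+-comm b 1#) (cong -_ (+-comm b 1#))) ⟩
    (1# + a) + - (1# + b)           ≡⟨ sym (cong₂ (λ x y → x + - y) (1+× m 1#) (1+× n 1#)) ⟩
    suc m · 1# + - (suc n · 1#)     ∎
    where a = m · 1#; b = n · 1#

  ⟦+⟧ : ∀ i j → ⟦ i ℤ.+ j ⟧ℤ ≡ ⟦ i ⟧ℤ + ⟦ j ⟧ℤ
  ⟦+⟧ (ℤ.+ m) (ℤ.+ n) = ×-homo-+ 1# m n
  ⟦+⟧ (ℤ.+ m) -[1+ n ] = ⟦⊖⟧ m (suc n)
  ⟦+⟧ -[1+ m ] (ℤ.+ n) = trans (⟦⊖⟧ n (suc m)) (+-comm _ _)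
  ⟦+⟧ -[1+ m ] -[1+ n ] = begin
    - (suc (suc (m ℕ.+ n)) · 1#)         ≡⟨ cong (λ k → - (suc k · 1#)) (sym (ℕP.+-suc m n)) ⟩
    - ((suc m ℕ.+ suc n) · 1#)           ≡⟨ cong -_ (×-homo-+ 1# (suc m) (suc n)) ⟩
    - (suc m · 1# + suc n · 1#)          ≡⟨ sym (-‿+-comm _ _) ⟩
    - (suc m · 1#) + - (suc n · 1#)      ∎

  signed : Sign → ℕ → Carrier
  signed Sign.+ n = n · 1#
  signed Sign.- n = - (n · 1#)

  ⟦◃⟧ : ∀ s n → ⟦ s ℤ.◃ n ⟧ℤ ≡ signed s n
  ⟦◃⟧ Sign.+ zero = refl
  ⟦◃⟧ Sign.- zero = sym -0#≈0#
  ⟦◃⟧ Sign.+ (suc n) = refl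
  ⟦◃⟧ Sign.- (suc n) = refl

  ⟦*⟧ : ∀ i j → ⟦ i ℤ.* j ⟧ℤ ≡ ⟦ i ⟧ℤ * ⟦ j ⟧ℤ
  ⟦*⟧ (ℤ.+ m) (ℤ.+ n) = trans (⟦◃⟧ Sign.+ (m ℕ.* n)) (×1-homo-* m n)
  ⟦*⟧ (ℤ.+ m) -[1+ n ] = trans (⟦◃⟧ Sign.- (m ℕ.* suc n))
    (trans (cong -_ (×1-homo-* m (suc n))) (-‿distribʳ-* _ _))
  ⟦*⟧ -[1+ m ] (ℤ.+ n) = trans (⟦◃⟧ Sign.- (suc m ℕ.* n))
    (trans (cong -_ (×1-homo-* (suc m) n)) (-‿distribˡ-* _ _))
  ⟦*⟧ -[1+ m ] -[1+ n ] = trans (⟦◃⟧ Sign.+ (suc m ℕ.* suc n)) (trans (×1-homo-* (suc m) (suc n))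
    (trans (sym (-‿involutive _)) (trans (cong -_ (-‿distribˡ-* _ _)) (-‿distribʳ-* _ _))))

  ⟦-⟧ : ∀ i → ⟦ ℤ.- i ⟧ℤ ≡ - ⟦ i ⟧ℤ
  ⟦-⟧ (ℤ.+ zero) = sym -0#≈0#
  ⟦-⟧ (ℤ.+ suc n) = refl
  ⟦-⟧ -[1+ n ] = sym (-‿involutive _)

  ℤ⟶F : ℤ.+-*-rawRing -Raw-AlmostCommutative⟶ fromCommutativeRing commutativeRing
  ℤ⟶F = record { ⟦_⟧ = ⟦_⟧ℤ ; +-homo = ⟦+⟧ ; *-homo = ⟦*⟧ ; -‿homo = ⟦-⟧ ; 0-homo = refl ; 1-homo = refl }

  ℤ-equal? : (i j : ℤ) → Maybe (⟦ i ⟧ℤ ≡ ⟦ j ⟧ℤ)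
  ℤ-equal? i j with i ℤ.≟ j
  ... | yes i≡j = just (cong ⟦_⟧ℤ i≡j)
  ... | no _ = nothing

  open import Algebra.Solver.Ring ℤ.+-*-rawRing (fromCommutativeRing commutativeRing) ℤ⟶F ℤ-equal? public

  :0 :1 : ∀ {n} → Polynomial n
  :0 = con (ℤ.+ 0)
  :1 = con (ℤ.+ 1)

module FieldTheory (F : FiniteField) where
  open FiniteField F
  open FieldSolver F public
  open ≡-Reasoning

  1≢0 : 1# ≢ 0#
  1≢0 e = 0≢1 (sym e)

  _⁻¹ : ∀ x → x ≢ 0# → Carrier
  (x ⁻¹) x≢0 = proj₁ (inverse x x≢0)

  inverseʳ : ∀ x (x≢0 : x ≢ 0#) → x * (x ⁻¹) x≢0 ≡ 1#
  inverseʳ x x≢0 = proj₂ (inverse x x≢0)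

  *-cancelˡ : ∀ {x a b} → x ≢ 0# → x * a ≡ x * b → a ≡ b
  *-cancelˡ {x} {a} {b} x≢0 e = begin
    a                  ≡⟨ sym (*-identityˡ a) ⟩
    1# * a             ≡⟨ cong (_* a) (sym (trans (*-comm y x) (inverseʳ x x≢0))) ⟩
    (y * x) * a        ≡⟨ *-assoc y x a ⟩
    y * (x * a)        ≡⟨ cong (y *_) e ⟩
    y * (x * b)        ≡⟨ sym (*-assoc y x b) ⟩
    (y * x) * b        ≡⟨ cong (_* b) (trans (*-comm y x) (inverseʳ x x≢0)) ⟩
    1# * b             ≡⟨ *-identityˡ b ⟩
    b                  ∎
    where y = (x ⁻¹) x≢0

  zero-product : ∀ {x y} → x * y ≡ 0# → x ≡ 0# ⊎ y ≡ 0#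
  zero-product {x} {y} e with x ≟ 0#
  ... | yes x≡0 = inj₁ x≡0
  ... | no x≢0 = inj₂ (*-cancelˡ x≢0 (trans e (sym (zeroʳ x))))

  *-nonzero : ∀ {x y} → x ≢ 0# → y ≢ 0# → x * y ≢ 0#
  *-nonzero x≢0 y≢0 e with zero-product e
  ... | inj₁ x≡0 = x≢0 x≡0
  ... | inj₂ y≡0 = y≢0 y≡0

  inverse-nonzero : ∀ x (x≢0 : x ≢ 0#) → (x ⁻¹) x≢0 ≢ 0#
  inverse-nonzero x x≢0 e = 1≢0 (trans (sym (inverseʳ x x≢0)) (trans (cong (x *_) e) (zeroʳ x)))

  neg-nonzero : ∀ {x} → x ≢ 0# → - x ≢ 0#
  neg-nonzero {x} x≢0 e = x≢0 (trans (sym (-‿involutive x)) (trans (cong -_ e) -0#≈0#))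

  difference-zero : ∀ {x y} → x + - y ≡ 0# → x ≡ y
  difference-zero {x} {y} e = begin
    x                ≡⟨ solve 2 (λ x y → x := (x :+ :- y) :+ y) refl x y ⟩
    (x + - y) + y    ≡⟨ cong (_+ y) e ⟩
    0# + y           ≡⟨ +-identityˡ y ⟩
    y                ∎

  neg-injective : ∀ {x y} → - x ≡ - y → x ≡ y
  neg-injective {x} {y} e = trans (sym (-‿involutive x)) (trans (cong -_ e) (-‿involutive y))

  difference-nonzero : ∀ {x y} → x ≢ y → x + - y ≢ 0#
  difference-nonzero x≢y e = x≢y (difference-zero e)

  ^-+ : ∀ x a b → x ^ (a ℕ.+ b) ≡ x ^ a * x ^ b
  ^-+ x zero b = sym (*-identityˡ _)
  ^-+ x (suc a) b = trans (cong (x *_) (^-+ x a b)) (sym (*-assoc _ _ _))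

  ^-double : ∀ x k → x ^ (2 ℕ.* k) ≡ x ^ k * x ^ k
  ^-double x k = trans (cong (λ j → x ^ (k ℕ.+ j)) (ℕP.+-identityʳ k)) (^-+ x k k)

  ^-nonzero : ∀ {x} → x ≢ 0# → ∀ k → x ^ k ≢ 0#
  ^-nonzero x≢0 zero = 1≢0
  ^-nonzero x≢0 (suc k) = *-nonzero x≢0 (^-nonzero x≢0 k)

  ^-mod : ∀ {x} K .{{_ : ℕ.NonZero K}} → x ^ K ≡ 1# → ∀ e → x ^ e ≡ x ^ (e % K)
  ^-mod {x} K xᴷ≡1 e = begin
    x ^ e                            ≡⟨ cong (x ^_) (m≡m%n+[m/n]*n e K) ⟩
    x ^ (e % K ℕ.+ (e / K) ℕ.* K)    ≡⟨ ^-+ x (e % K) _ ⟩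
    x ^ (e % K) * x ^ ((e / K) ℕ.* K) ≡⟨ cong (x ^ (e % K) *_) (^-multiple (e / K)) ⟩
    x ^ (e % K) * 1#                 ≡⟨ *-identityʳ _ ⟩
    x ^ (e % K)                      ∎
    where
    ^-multiple : ∀ d → x ^ (d ℕ.* K) ≡ 1#
    ^-multiple zero = refl
    ^-multiple (suc d) = trans (^-+ x K (d ℕ.* K))
      (trans (cong₂ _*_ xᴷ≡1 (^-multiple d)) (*-identityˡ 1#))

  ^-gap : ∀ {x} i k → x ≢ 0# → x ^ i ≡ x ^ (i ℕ.+ k) → x ^ k ≡ 1#
  ^-gap {x} i k x≢0 e = sym (*-cancelˡ (^-nonzero x≢0 i) (begin
    x ^ i * 1#        ≡⟨ *-identityʳ _ ⟩
    x ^ i             ≡⟨ e ⟩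
    x ^ (i ℕ.+ k)     ≡⟨ ^-+ x i k ⟩
    x ^ i * x ^ k     ∎))

  private
    lookup-injective : ∀ {xs : List Carrier} → Unique xs → ∀ i j → lookup xs i ≡ lookup xs j → i ≡ j
    lookup-injective (_ ∷ _) Fin.zero Fin.zero _ = refl
    lookup-injective (x≢ ∷ _) Fin.zero (Fin.suc j) e = ⊥-elim (All.lookup x≢ (MemP.∈-lookup j) e)
    lookup-injective (x≢ ∷ _) (Fin.suc i) Fin.zero e = ⊥-elim (All.lookup x≢ (MemP.∈-lookup i) (sym e))
    lookup-injective (_ ∷ u) (Fin.suc i) (Fin.suc j) e = cong Fin.suc (lookup-injective u i j e)

  injection-bound : ∀ {n} (f : Carrier → Fin n) → (∀ x y → f x ≡ f y → x ≡ y) → order ≤ n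
  injection-bound {n} f f-inj with order ℕP.≤? n
  ... | yes order≤n = order≤n
  ... | no order≰n with FinP.pigeonhole (ℕP.≰⇒> order≰n) (λ i → f (lookup elements i))
  ...   | i , j , i<j , e = ⊥-elim (FinP.<-irrefl (lookup-injective unique i j (f-inj _ _ e)) i<j)

  few-powers-bound : ∀ g n → (∀ x → x ≢ 0# → ∃[ i ] i < n × g ^ i ≡ x) → order ≤ suc n
  few-powers-bound g n powers = injection-bound code code-injective
    where
    code : Carrier → Fin (suc n)
    code x with x ≟ 0#
    ... | yes _ = Fin.zero
    ... | no x≢0 with powers x x≢0
    ...   | i , i<n , _ = Fin.suc (Fin.fromℕ< i<n)

    code-injective : ∀ x y → code x ≡ code y → x ≡ y
    code-injective x y e with x ≟ 0# | y ≟ 0#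
    ... | yes x≡0 | yes y≡0 = trans x≡0 (sym y≡0)
    ... | no x≢0 | no y≢0 with powers x x≢0 | powers y y≢0
    ...   | i , i<n , gⁱ≡x | j , j<n , gʲ≡y =
      trans (sym gⁱ≡x) (trans (cong (g ^_) i≡j) gʲ≡y)
      where
      i≡j : i ≡ j
      i≡j = trans (sym (FinP.toℕ-fromℕ< i<n))
              (trans (cong Fin.toℕ (FinP.suc-injective e)) (FinP.toℕ-fromℕ< j<n))

  nonzero-collision : ∀ {n} → order ≡ suc n → (g : Fin (suc n) → Carrier) → (∀ i → g i ≢ 0#) →
                      ∃[ i ] ∃[ j ] i Fin.< j × g i ≡ g j
  nonzero-collision {n} order≡ g g≢0 = repetition (FinP.pigeonhole ℕP.≤-refl punched)
    where
    position : Carrier → Fin (suc n)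
    position x = subst Fin order≡ (Any.index (complete x))

    position-injective : ∀ {x y} → position x ≡ position y → x ≡ y
    position-injective {x} {y} e =
      MemSP.index-injective (≡.setoid Carrier) (complete x) (complete y) (subst-injective order≡ e)
      where
      subst-injective : ∀ {a b} (p : a ≡ b) {u v : Fin a} → subst Fin p u ≡ subst Fin p v → u ≡ v
      subst-injective refl e = e

    0≢g : ∀ i → position 0# ≢ position (g i)
    0≢g i e = g≢0 i (sym (position-injective e))

    -- the position of g i among the nonzero elements
    punched : Fin (suc n) → Fin n
    punched i = Fin.punchOut (0≢g i)

    repetition : (∃[ i ] ∃[ j ] i Fin.< j × punched i ≡ punched j) → ∃[ i ] ∃[ j ] i Fin.< j × g i ≡ g j
    repetition (i , j , i<j , e) = i , j , i<j , position-injective (FinP.punchOut-injective (0≢g i) (0≢g j) e)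

module PrimitiveElement (F : FiniteField) (ξ : FiniteField.Carrier F) (prim : FiniteField.IsPrimitive F ξ)
                        (N : ℕ) (order≡ : FiniteField.order F ≡ suc N) (1<N : 1 < N) where
  open FiniteField F
  open FieldTheory F
  open ≡-Reasoning

  instance
    N-nonZero : ℕ.NonZero N
    N-nonZero = ℕ.>-nonZero (ℕP.<-trans (s≤s z≤n) 1<N)

  -- If ξ were 0, every nonzero element would equal ξ^0 = 1, so order ≤ 2.
  ξ≢0 : ξ ≢ 0#
  ξ≢0 ξ≡0 = ℕP.<-irrefl refl (ℕP.≤-trans (s≤s 1<N) (ℕP.≤-trans (ℕP.≤-reflexive (sym order≡)) order≤2))
    where
    only-one : ∀ x → x ≢ 0# → ∃[ i ] i < 1 × ξ ^ i ≡ x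
    only-one x x≢0 with prim x x≢0
    ... | zero , ξ⁰≡x = 0 , s≤s z≤n , ξ⁰≡x
    ... | suc k , ξᵏ⁺¹≡x = ⊥-elim (x≢0 (trans (sym ξᵏ⁺¹≡x) (trans (cong (_* ξ ^ k) ξ≡0) (zeroˡ _))))

    order≤2 : order ≤ 2
    order≤2 = few-powers-bound ξ 1 only-one

  -- If ξ^(k+1) = 1 then ξ^0, …, ξ^k are all the nonzero elements, so N ≤ k + 1.
  period-bound : ∀ k → ξ ^ suc k ≡ 1# → N ≤ suc k
  period-bound k ξᵏ⁺¹≡1 = ℕP.≤-pred (subst (_≤ suc (suc k)) order≡ (few-powers-bound ξ (suc k) reduced-log))
    where
    reduced-log : ∀ x → x ≢ 0# → ∃[ i ] i < suc k × ξ ^ i ≡ x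
    reduced-log x x≢0 with prim x x≢0
    ... | e , ξᵉ≡x = e % suc k , m%n<n e (suc k) , trans (sym (^-mod (suc k) ξᵏ⁺¹≡1 e)) ξᵉ≡x

  -- Among ξ^0, …, ξ^N two powers coincide; their gap is a period ≤ N, hence = N.
  ξ^N≡1 : ξ ^ N ≡ 1#
  ξ^N≡1 with nonzero-collision order≡ (λ i → ξ ^ Fin.toℕ i) (λ i → ^-nonzero ξ≢0 (Fin.toℕ i))
  ... | i , j , i<j , ξⁱ≡ξʲ = subst (λ k → ξ ^ k ≡ 1#) (ℕP.≤-antisym gap≤N N≤gap) ξ^gap≡1
    where
    gap = Fin.toℕ j ∸ Fin.toℕ i
    gap-eq : Fin.toℕ i ℕ.+ gap ≡ Fin.toℕ j
    gap-eq = ℕP.m+[n∸m]≡n (ℕP.<⇒≤ i<j)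
    ξ^gap≡1 : ξ ^ gap ≡ 1#
    ξ^gap≡1 = ^-gap (Fin.toℕ i) gap ξ≢0 (trans ξⁱ≡ξʲ (cong (ξ ^_) (sym gap-eq)))
    gap≤N : gap ≤ N
    gap≤N = ℕP.≤-trans (ℕP.m∸n≤m (Fin.toℕ j) (Fin.toℕ i)) (ℕP.≤-pred (FinP.toℕ<n j))
    N≤gap : N ≤ gap
    N≤gap with gap | ξ^gap≡1 | ℕP.m<n⇒0<n∸m i<j
    ... | suc k | ξᵏ⁺¹≡1 | _ = period-bound k ξᵏ⁺¹≡1

  -- ξ^a ≠ ξ^b for a < b < N, since their gap would be a period smaller than N.
  ^-distinct : ∀ {a b} → a < b → b < N → ξ ^ a ≢ ξ ^ b
  ^-distinct {a} {b} a<b b<N ξᵃ≡ξᵇ with b ∸ a | ℕP.m+[n∸m]≡n (ℕP.<⇒≤ a<b) | ℕP.m<n⇒0<n∸m a<b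
  ... | suc k | a+k≡b | _ = ℕP.<-irrefl refl (ℕP.<-≤-trans b<N (ℕP.≤-trans (period-bound k ξᵏ⁺¹≡1) k+1≤b))
    where
    ξᵏ⁺¹≡1 : ξ ^ suc k ≡ 1#
    ξᵏ⁺¹≡1 = ^-gap a (suc k) ξ≢0 (trans ξᵃ≡ξᵇ (cong (ξ ^_) (sym a+k≡b)))
    k+1≤b : suc k ≤ b
    k+1≤b = subst (suc k ≤_) a+k≡b (ℕP.m≤n+m (suc k) a)

  ^-injective : ∀ {i j} → i < N → j < N → ξ ^ i ≡ ξ ^ j → i ≡ j
  ^-injective {i} {j} i<N j<N ξⁱ≡ξʲ with ℕP.<-cmp i j
  ... | tri< i<j _ _ = ⊥-elim (^-distinct i<j j<N ξⁱ≡ξʲ)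
  ... | tri≈ _ i≡j _ = i≡j
  ... | tri> _ _ j<i = ⊥-elim (^-distinct j<i i<N (sym ξⁱ≡ξʲ))

  discrete-log : ∀ y → y ≢ 0# → ∃[ r ] r < N × ξ ^ r ≡ y
  discrete-log y y≢0 with prim y y≢0
  ... | e , ξᵉ≡y = e % N , m%n<n e N , trans (sym (^-mod N ξ^N≡1 e)) ξᵉ≡y

  order-divides : ∀ k → ξ ^ k ≡ 1# → N ∣ k
  order-divides k ξᵏ≡1 = m%n≡0⇒n∣m k N
    (^-injective (m%n<n k N) (ℕP.<-trans (s≤s z≤n) 1<N) (trans (sym (^-mod N ξ^N≡1 k)) ξᵏ≡1))

  module OddHalfOrder (h : ℕ) (N≡2h : N ≡ 2 ℕ.* h) (h-odd : ¬ 2 ∣ h) where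

    h≢0 : h ≢ 0
    h≢0 refl = h-odd (divides 0 refl)

    h<N : h < N
    h<N = subst (h <_) (sym (trans N≡2h (2*-as-sum h))) (ℕP.m<m+n h (ℕP.n≢0⇒n>0 h≢0))

    -- (ξ^h - 1)(ξ^h + 1) = ξ^N - 1 = 0
    ξ^h-root : (ξ ^ h + - 1#) * (ξ ^ h + 1#) ≡ 0#
    ξ^h-root = begin
        (ξ ^ h + - 1#) * (ξ ^ h + 1#)  ≡⟨ solve 1 (λ y → (y :+ :- :1) :* (y :+ :1) := y :* y :+ :- :1) refl (ξ ^ h) ⟩
        ξ ^ h * ξ ^ h + - 1#           ≡⟨ cong (_+ - 1#) (trans (sym (^-double ξ h)) (trans (cong (ξ ^_) (sym N≡2h)) ξ^N≡1)) ⟩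
        1# + - 1#                      ≡⟨ -‿inverseʳ 1# ⟩
        0#                             ∎

    ξ^h≡-1 : ξ ^ h ≡ - 1#
    ξ^h≡-1 with zero-product ξ^h-root
    ... | inj₁ ξʰ-1≡0 = ⊥-elim (^-distinct (ℕP.n≢0⇒n>0 h≢0) h<N (sym (difference-zero ξʰ-1≡0)))
    ... | inj₂ ξʰ+1≡0 = trans (solve 1 (λ y → y := (y :+ :1) :+ :- :1) refl (ξ ^ h)) (trans (cong (_+ - 1#) ξʰ+1≡0) (+-identityˡ _))

    -- If y² = -1 = ξ^h and y = ξ^r, then ξ^(2r+h) = 1, so 2 ∣ N ∣ 2r + h and hence 2 ∣ h.
    minus-one-nonsquare : ∀ y → y * y ≢ - 1#
    minus-one-nonsquare y y²≡-1 with y ≟ 0#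
    ... | yes y≡0 = 1≢0 (begin
      1#          ≡⟨ sym (-‿involutive 1#) ⟩
      - - 1#      ≡⟨ cong -_ (sym y²≡-1) ⟩
      - (y * y)   ≡⟨ cong (λ z → - (z * y)) y≡0 ⟩
      - (0# * y)  ≡⟨ cong -_ (zeroˡ y) ⟩
      - 0#        ≡⟨ -0#≈0# ⟩
      0#          ∎)
    ... | no y≢0 with discrete-log y y≢0
    ...   | r , _ , ξʳ≡y = h-odd (∣m+n∣m⇒∣n (∣-trans 2∣N (order-divides (2 ℕ.* r ℕ.+ h) ξ^[2r+h]≡1)) (m∣m*n r))
      where
      2∣N : 2 ∣ N
      2∣N = subst (2 ∣_) (sym N≡2h) (m∣m*n h)
      ξ^[2r+h]≡1 : ξ ^ (2 ℕ.* r ℕ.+ h) ≡ 1#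
      ξ^[2r+h]≡1 = begin
        ξ ^ (2 ℕ.* r ℕ.+ h)    ≡⟨ ^-+ ξ (2 ℕ.* r) h ⟩
        ξ ^ (2 ℕ.* r) * ξ ^ h  ≡⟨ cong₂ _*_ (trans (^-double ξ r) (cong₂ _*_ ξʳ≡y ξʳ≡y)) ξ^h≡-1 ⟩
        (y * y) * - 1#         ≡⟨ cong (_* - 1#) y²≡-1 ⟩
        - 1# * - 1#            ≡⟨ solve 0 (:- :1 :* :- :1 := :1) refl ⟩
        1#                     ∎

    -- Consequently x² + z² ≠ 0 whenever z ≠ 0 (else (x/z)² = -1).
    sum-of-squares : ∀ {x z} → z ≢ 0# → x * x + z * z ≢ 0#
    sum-of-squares {x} {z} z≢0 x²+z²≡0 = minus-one-nonsquare (x * w) (begin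
      (x * w) * (x * w)
        ≡⟨ solve 3 (λ x z w → (x :* w) :* (x :* w) := (x :* x :+ z :* z) :* (w :* w) :+ :- ((z :* w) :* (z :* w))) refl x z w ⟩
      (x * x + z * z) * (w * w) + - ((z * w) * (z * w))
        ≡⟨ cong₂ (λ a b → a * (w * w) + - (b * b)) x²+z²≡0 (inverseʳ z z≢0) ⟩
      0# * (w * w) + - (1# * 1#)
        ≡⟨ solve 1 (λ u → :0 :* u :+ :- (:1 :* :1) := :- :1) refl (w * w) ⟩
      - 1# ∎)
      where
      w = (z ⁻¹) z≢0

module ProjectivePlane (F : FiniteField) where
  open FiniteField F
  open FieldTheory F
  open PG2 F
  open ≡-Reasoning

  ∼-refl : ∀ v → v ∼ v
  ∼-refl (a , b , c) = 1# , 1≢0 , sym (*-identityˡ a) , sym (*-identityˡ b) , sym (*-identityˡ c)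

  ∼-sym : ∀ {u v} → u ∼ v → v ∼ u
  ∼-sym {v = a , b , c} (t , t≢0 , refl , refl , refl) =
    (t ⁻¹) t≢0 , inverse-nonzero t t≢0 , unscale a , unscale b , unscale c
    where
    unscale : ∀ z → z ≡ (t ⁻¹) t≢0 * (t * z)
    unscale z = sym (begin
      (t ⁻¹) t≢0 * (t * z)   ≡⟨ sym (*-assoc _ t z) ⟩
      ((t ⁻¹) t≢0 * t) * z   ≡⟨ cong (_* z) (trans (*-comm _ t) (inverseʳ t t≢0)) ⟩
      1# * z                 ≡⟨ *-identityˡ z ⟩
      z                      ∎)

  ∼-trans : ∀ {u v w} → u ∼ v → v ∼ w → u ∼ w
  ∼-trans (t , t≢0 , refl , refl , refl) (s , s≢0 , refl , refl , refl) =
    t * s , *-nonzero t≢0 s≢0 , sym (*-assoc t s _) , sym (*-assoc t s _) , sym (*-assoc t s _)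

  affine-∼ : ∀ {a b a' b'} → (1# , a , b) ∼ (1# , a' , b') → a ≡ a' × b ≡ b'
  affine-∼ {a' = a'} {b' = b'} (t , _ , 1≡t1 , a≡ta' , b≡tb') =
    trans a≡ta' (trans (cong (_* a') t≡1) (*-identityˡ a')) ,
    trans b≡tb' (trans (cong (_* b') t≡1) (*-identityˡ b'))
    where
    t≡1 : t ≡ 1#
    t≡1 = sym (trans 1≡t1 (*-identityʳ t))

  affine≁infinite : ∀ {a b a' b'} → ¬ ((1# , a , b) ∼ (0# , a' , b'))
  affine≁infinite (t , _ , 1≡t0 , _) = 1≢0 (trans 1≡t0 (zeroʳ t))

  private
    rescale : ∀ u z (u≢0 : u ≢ 0#) → z ≡ u * (z * (u ⁻¹) u≢0)
    rescale u z u≢0 = sym (begin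
      u * (z * (u ⁻¹) u≢0)    ≡⟨ solve 3 (λ u z w → u :* (z :* w) := z :* (u :* w)) refl u z _ ⟩
      z * (u * (u ⁻¹) u≢0)    ≡⟨ cong (z *_) (inverseʳ u u≢0) ⟩
      z * 1#                  ≡⟨ *-identityʳ z ⟩
      z                       ∎)

  affine-chart : ∀ {u v w} (u≢0 : u ≢ 0#) → (u , v , w) ∼ (1# , v * (u ⁻¹) u≢0 , w * (u ⁻¹) u≢0)
  affine-chart {u} {v} {w} u≢0 = u , u≢0 , sym (*-identityʳ u) , rescale u v u≢0 , rescale u w u≢0

  infinite-chart : ∀ {u v w} → u ≡ 0# → (v≢0 : v ≢ 0#) → (u , v , w) ∼ (0# , 1# , w * (v ⁻¹) v≢0)
  infinite-chart {u} {v} {w} u≡0 v≢0 = v , v≢0 , trans u≡0 (sym (zeroʳ v)) , sym (*-identityʳ v) , rescale v w v≢0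

  private
    D : ∀ {n} → (a₀ a₁ a₂ b₀ b₁ b₂ c₀ c₁ c₂ : Polynomial n) → Polynomial n
    D a₀ a₁ a₂ b₀ b₁ b₂ c₀ c₁ c₂ =
      a₀ :* (b₁ :* c₂ :+ :- (b₂ :* c₁)) :+ :- (a₁ :* (b₀ :* c₂ :+ :- (b₂ :* c₀))) :+ a₂ :* (b₀ :* c₁ :+ :- (b₁ :* c₀))

  det-scale : ∀ t r s a b c u v w x y z →
    det (t * a , t * b , t * c) (r * u , r * v , r * w) (s * x , s * y , s * z) ≡ t * (r * (s * det (a , b , c) (u , v , w) (x , y , z)))
  det-scale = solve 12 (λ t r s a b c u v w x y z →
    D (t :* a) (t :* b) (t :* c) (r :* u) (r :* v) (r :* w) (s :* x) (s :* y) (s :* z) := t :* (r :* (s :* D a b c u v w x y z))) refl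

  det-swap₁₂ : ∀ a b c u v w x y z → det (u , v , w) (a , b , c) (x , y , z) ≡ - det (a , b , c) (u , v , w) (x , y , z)
  det-swap₁₂ = solve 9 (λ a b c u v w x y z → D u v w a b c x y z := :- D a b c u v w x y z) refl

  det-swap₂₃ : ∀ a b c u v w x y z → det (a , b , c) (x , y , z) (u , v , w) ≡ - det (a , b , c) (u , v , w) (x , y , z)
  det-swap₂₃ = solve 9 (λ a b c u v w x y z → D a b c x y z u v w := :- D a b c u v w x y z) refl

  noncollinear-swap₁₂ : ∀ {A B C} → ¬ Collinear A B C → ¬ Collinear B A C
  noncollinear-swap₁₂ {a , b , c} {u , v , w} {x , y , z} ¬col col =
    neg-nonzero ¬col (trans (sym (det-swap₁₂ a b c u v w x y z)) col)

  noncollinear-swap₂₃ : ∀ {A B C} → ¬ Collinear A B C → ¬ Collinear A C B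
  noncollinear-swap₂₃ {a , b , c} {u , v , w} {x , y , z} ¬col col =
    neg-nonzero ¬col (trans (sym (det-swap₂₃ a b c u v w x y z)) col)

  collinear-rotate : ∀ {A B X} → Collinear A B X → Collinear X A B
  collinear-rotate {a , b , c} {u , v , w} {x , y , z} col = begin
    det (x , y , z) (a , b , c) (u , v , w)     ≡⟨ det-swap₁₂ a b c x y z u v w ⟩
    - det (a , b , c) (x , y , z) (u , v , w)   ≡⟨ cong -_ (det-swap₂₃ a b c u v w x y z) ⟩
    - - det (a , b , c) (u , v , w) (x , y , z) ≡⟨ cong (λ d → - - d) col ⟩
    - - 0#                                      ≡⟨ -‿involutive 0# ⟩
    0#                                          ∎

  collinear-resp-∼ : ∀ {A A' B B' C C'} → A ∼ A' → B ∼ B' → C ∼ C' → Collinear A' B' C' → Collinear A B C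
  collinear-resp-∼ {A' = a , b , c} {B' = u , v , w} {C' = x , y , z} (t , _ , refl , refl , refl) (r , _ , refl , refl , refl) (s , _ , refl , refl , refl) col = begin
    det (t * a , t * b , t * c) (r * u , r * v , r * w) (s * x , s * y , s * z) ≡⟨ det-scale t r s a b c u v w x y z ⟩
    t * (r * (s * det (a , b , c) (u , v , w) (x , y , z)))                   ≡⟨ cong (λ d → t * (r * (s * d))) col ⟩
    t * (r * (s * 0#))                                                          ≡⟨ cong (λ d → t * (r * d)) (zeroʳ s) ⟩
    t * (r * 0#)                                                                ≡⟨ cong (t *_) (zeroʳ r) ⟩
    t * 0#                                                                      ≡⟨ zeroʳ t ⟩
    0#                                                                          ∎

  ∈P-resp-∼ : ∀ {A B S} → A ∼ B → B ∈P S → A ∈P S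
  ∈P-resp-∼ A∼B = Any.map (∼-trans A∼B)

  bisecant-resp-∼ : ∀ {X X' S} → X ∼ X' → OnBisecant X' S → OnBisecant X S
  bisecant-resp-∼ X∼X' (A , B , A∈S , B∈S , A≁B , col) =
    A , B , A∈S , B∈S , A≁B , collinear-resp-∼ (∼-refl A) (∼-refl B) X∼X' col

  bisecant-mono : ∀ {X S T} → (∀ {A} → A ∈P S → A ∈P T) → OnBisecant X S → OnBisecant X T
  bisecant-mono S⊆T (A , B , A∈S , B∈S , A≁B , col) = A , B , S⊆T A∈S , S⊆T B∈S , A≁B , col

  bisecant-blocks : ∀ {X S} → ¬ (X ∈P S) → OnBisecant X S → ¬ IsArc (X ∷ S)
  bisecant-blocks {X} X∉S (A , B , A∈S , B∈S , A≁B , col) arc =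
    arc X A B (here (∼-refl X)) (there A∈S) (there B∈S)
      (λ X∼A → X∉S (∈P-resp-∼ X∼A A∈S)) (λ X∼B → X∉S (∈P-resp-∼ X∼B B∈S)) A≁B (collinear-rotate col)

  det-vertical : ∀ x X y Y → det (0# , 1# , 0#) (1# , x , X) (1# , y , Y) ≡ X + - Y
  det-vertical = solve 4 (λ x X y Y → D :0 :1 :0 :1 x X :1 y Y := X :+ :- Y) refl

  det-axis : ∀ a b u w → det (1# , 0# , a) (1# , 0# , b) (u , 0# , w) ≡ 0#
  det-axis = solve 4 (λ a b u w → D :1 :0 a :1 :0 b u :0 w := :0) refl

  det-axis-affine : ∀ a b x X → det (1# , 0# , a) (1# , 0# , b) (1# , x , X) ≡ x * (a + - b)
  det-axis-affine = solve 4 (λ a b x X → D :1 :0 a :1 :0 b :1 x X := x :* (a :+ :- b)) refl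

  det-chord : ∀ a x y → det (1# , 0# , - a) (1# , x , x * x) (1# , y , y * y) ≡ (y + - x) * (x * y + - a)
  det-chord = solve 3 (λ a x y → D :1 :0 (:- a) :1 x (x :* x) :1 y (y :* y) := (y :+ :- x) :* (x :* y :+ :- a)) refl

  det-vandermonde : ∀ x y z → det (1# , x , x * x) (1# , y , y * y) (1# , z , z * z) ≡ (y + - x) * ((z + - x) * (z + - y))
  det-vandermonde = solve 3 (λ x y z → D :1 x (x :* x) :1 y (y :* y) :1 z (z :* z) := (y :+ :- x) :* ((z :+ :- x) :* (z :+ :- y))) refl

module ArcConstruction (F : FiniteField) (ξ : FiniteField.Carrier F) (prim : FiniteField.IsPrimitive F ξ)
                       (h : ℕ) (h-odd : ¬ 2 ∣ h) (order≡ : FiniteField.order F ≡ suc (2 ℕ.* h))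
                       (J : ℕ) (0<J : 0 < J) (J<h : J < h) where
  open FiniteField F
  open FieldTheory F
  open PG2 F
  open ProjectivePlane F
  open Construction ξ
  open ≡-Reasoning

  -- the order of ξ
  N : ℕ
  N = 2 ℕ.* h

  2J<N : 2 ℕ.* J < N
  2J<N = ℕP.*-monoʳ-< 2 J<h

  open PrimitiveElement F ξ prim N order≡ (ℕP.≤-<-trans (ℕP.≤-trans 0<J (ℕP.m≤m+n J _)) 2J<N)
  open OddHalfOrder h refl h-odd

  E C : ℕ → Vec3
  E t = (1# , 0# , - (ξ ^ (2 ℕ.* t)))
  C d = (1# , ξ ^ d , ξ ^ (2 ℕ.* d))

  C-on-conic : ∀ d → C d ≡ (1# , ξ ^ d , ξ ^ d * ξ ^ d)
  C-on-conic d = cong (λ X → (1# , ξ ^ d , X)) (^-double ξ d)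

  window-distinct : ∀ {a b} → a ≤ 2 ℕ.* J → b ≤ 2 ℕ.* J → a ≢ b → ξ ^ a ≢ ξ ^ b
  window-distinct a≤2J b≤2J a≢b ξᵃ≡ξᵇ =
    a≢b (^-injective (ℕP.≤-<-trans a≤2J 2J<N) (ℕP.≤-<-trans b≤2J 2J<N) ξᵃ≡ξᵇ)

  ≤2J : ∀ {d} → d ≤ J → d ≤ 2 ℕ.* J
  ≤2J d≤J = ℕP.≤-trans d≤J (ℕP.m≤m+n _ _)

  square-distinct : ∀ {d e} → d ≤ J → e ≤ J → d ≢ e → ξ ^ (2 ℕ.* d) ≢ ξ ^ (2 ℕ.* e)
  square-distinct d≤J e≤J d≢e =
    window-distinct (ℕP.*-monoʳ-≤ 2 d≤J) (ℕP.*-monoʳ-≤ 2 e≤J) (λ 2d≡2e → d≢e (ℕP.*-cancelˡ-≡ _ _ 2 2d≡2e))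

  data Kind : Set where
    kP : Kind
    kE kC : ℕ → Kind

  point : Kind → Vec3
  point kP = P
  point (kE t) = E t
  point (kC d) = C d

  Valid : Kind → Set
  Valid kP = ⊤
  Valid (kE t) = t ≡ 0 ⊎ t ≡ J
  Valid (kC d) = d ≤ J

  _≺_ : Kind → Kind → Set
  kP ≺ kE _ = ⊤
  kP ≺ kC _ = ⊤
  kE _ ≺ kC _ = ⊤
  kE t ≺ kE u = t < u
  kC d ≺ kC e = d < e
  _ ≺ _ = ⊥

  compare : ∀ a b → a ≺ b ⊎ a ≡ b ⊎ b ≺ a
  compare kP kP = inj₂ (inj₁ refl)
  compare kP (kE _) = inj₁ tt
  compare kP (kC _) = inj₁ tt
  compare (kE _) kP = inj₂ (inj₂ tt)
  compare (kE t) (kE u) with ℕP.<-cmp t u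
  ... | tri< t<u _ _ = inj₁ t<u
  ... | tri≈ _ t≡u _ = inj₂ (inj₁ (cong kE t≡u))
  ... | tri> _ _ u<t = inj₂ (inj₂ u<t)
  compare (kE _) (kC _) = inj₁ tt
  compare (kC _) kP = inj₂ (inj₂ tt)
  compare (kC _) (kE _) = inj₂ (inj₂ tt)
  compare (kC d) (kC e) with ℕP.<-cmp d e
  ... | tri< d<e _ _ = inj₁ d<e
  ... | tri≈ _ d≡e _ = inj₂ (inj₁ (cong kC d≡e))
  ... | tri> _ _ e<d = inj₂ (inj₂ e<d)

  E-index≤J : ∀ {t} → Valid (kE t) → t ≤ J
  E-index≤J (inj₁ refl) = z≤n
  E-index≤J (inj₂ refl) = ℕP.≤-refl

  -- For d < e ≤ J the chord C_d C_e misses E₀ and E_J: d + e ≠ 0 and d + e < 2J.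
  chord-exponent : ∀ {t d e} → Valid (kE t) → d < e → e ≤ J → d ℕ.+ e ≢ 2 ℕ.* t
  chord-exponent (inj₁ refl) d<e _ d+e≡0 = ℕP.<-irrefl (sym (ℕP.m+n≡0⇒n≡0 _ d+e≡0)) (ℕP.≤-<-trans z≤n d<e)
  chord-exponent (inj₂ refl) d<e e≤J d+e≡2J = ℕP.<-irrefl d+e≡2J (distinct-sum<double d<e e≤J)

  E-distinct : ∀ {t u} → Valid (kE t) → Valid (kE u) → t ≢ u → - (ξ ^ (2 ℕ.* t)) ≢ - (ξ ^ (2 ℕ.* u))
  E-distinct vt vu t≢u e = square-distinct (E-index≤J vt) (E-index≤J vu) t≢u (neg-injective e)

  vertical-collinear : ∀ {x X y Y} → Collinear P (1# , x , X) (1# , y , Y) → X ≡ Y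
  vertical-collinear {x} {X} {y} {Y} col = difference-zero (trans (sym (det-vertical x X y Y)) col)

  det-E-C-C : ∀ t d e → det (E t) (C d) (C e) ≡ (ξ ^ e + - (ξ ^ d)) * (ξ ^ d * ξ ^ e + - (ξ ^ (2 ℕ.* t)))
  det-E-C-C t d e = trans (cong₂ (det (E t)) (C-on-conic d) (C-on-conic e)) (det-chord _ _ _)

  det-C-C-C : ∀ d e f → det (C d) (C e) (C f) ≡ (ξ ^ e + - (ξ ^ d)) * ((ξ ^ f + - (ξ ^ d)) * (ξ ^ f + - (ξ ^ e)))
  det-C-C-C d e f = trans (cong₂ (λ A B → det A B (C f)) (C-on-conic d) (C-on-conic e))
                          (trans (cong (det _ _) (C-on-conic f)) (det-vandermonde _ _ _))

  conic-distinct : ∀ {d e} → d ≤ J → e ≤ J → d < e → ξ ^ e + - (ξ ^ d) ≢ 0#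
  conic-distinct d≤J e≤J d<e = difference-nonzero (window-distinct (≤2J e≤J) (≤2J d≤J) (ℕP.>⇒≢ d<e))

  increasing-noncollinear : ∀ a b c → a ≺ b → b ≺ c → Valid a → Valid b → Valid c →
                            ¬ Collinear (point a) (point b) (point c)
  increasing-noncollinear kP (kE t) (kE u) _ t<u _ vt vu col =
    E-distinct vt vu (ℕP.<⇒≢ t<u) (vertical-collinear col)
  -- (ξ^d)² = -(ξ^t)² would make -1 a square
  increasing-noncollinear kP (kE t) (kC d) _ _ _ vt d≤J col = sum-of-squares (^-nonzero ξ≢0 t) (begin
    ξ ^ d * ξ ^ d + ξ ^ t * ξ ^ t        ≡⟨ cong₂ _+_ (sym (^-double ξ d)) (sym (^-double ξ t)) ⟩
    ξ ^ (2 ℕ.* d) + ξ ^ (2 ℕ.* t)        ≡⟨ cong (_+ ξ ^ (2 ℕ.* t)) (sym (vertical-collinear col)) ⟩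
    - (ξ ^ (2 ℕ.* t)) + ξ ^ (2 ℕ.* t)      ≡⟨ -‿inverseˡ _ ⟩
    0#                                   ∎)
  increasing-noncollinear kP (kC d) (kC e) _ d<e _ d≤J e≤J col =
    square-distinct d≤J e≤J (ℕP.<⇒≢ d<e) (vertical-collinear col)
  increasing-noncollinear (kE t) (kE u) (kC d) t<u _ vt vu d≤J col
    with zero-product (trans (sym (det-axis-affine _ _ (ξ ^ d) (ξ ^ (2 ℕ.* d)))) col)
  ... | inj₁ ξᵈ≡0 = ^-nonzero ξ≢0 d ξᵈ≡0
  ... | inj₂ difference≡0 = E-distinct vt vu (ℕP.<⇒≢ t<u) (difference-zero difference≡0)
  increasing-noncollinear (kE t) (kC d) (kC e) _ d<e vt d≤J e≤J col with zero-product (trans (sym (det-E-C-C t d e)) col)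
  ... | inj₁ secant≡0 = conic-distinct d≤J e≤J d<e secant≡0
  ... | inj₂ through-E = window-distinct sum≤2J (ℕP.*-monoʳ-≤ 2 (E-index≤J vt)) (chord-exponent vt d<e e≤J)
                           (trans (^-+ ξ d e) (difference-zero through-E))
    where
    sum≤2J : d ℕ.+ e ≤ 2 ℕ.* J
    sum≤2J = ℕP.<⇒≤ (distinct-sum<double d<e e≤J)
  increasing-noncollinear (kC d) (kC e) (kC f) d<e e<f d≤J e≤J f≤J col with zero-product (trans (sym (det-C-C-C d e f)) col)
  ... | inj₁ ed≡0 = conic-distinct d≤J e≤J d<e ed≡0
  ... | inj₂ rest≡0 with zero-product rest≡0
  ...   | inj₁ fd≡0 = conic-distinct d≤J f≤J (ℕP.<-trans d<e e<f) fd≡0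
  ...   | inj₂ fe≡0 = conic-distinct e≤J f≤J e<f fe≡0
  increasing-noncollinear (kE t) (kE u) (kE v) t<u u<v vt vu vv _ = only-two-E vt vu vv t<u u<v
    where
    only-two-E : ∀ {t u v} → Valid (kE t) → Valid (kE u) → Valid (kE v) → t < u → u < v → ⊥
    only-two-E _ (inj₁ refl) _ () _
    only-two-E _ (inj₂ refl) (inj₁ refl) _ ()
    only-two-E _ (inj₂ refl) (inj₂ refl) _ J<J = ℕP.<-irrefl refl J<J

  conic-member : ∀ {A K d} → d ≤ K → A ∼ C d → Any (A ∼_) (conicPts K)
  conic-member d≤K A∼Cd = Mem.lose (MemP.∈-map⁺ C (MemP.∈-upTo⁺ (s≤s d≤K))) A∼Cd

  conic-view : ∀ {A K} → Any (A ∼_) (conicPts K) → ∃[ d ] d ≤ K × A ∼ C d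
  conic-view A∈ with Mem.find A∈
  ... | _ , B∈ , A∼B with MemP.∈-map⁻ C B∈
  ...   | d , d∈ , refl = d , ℕP.≤-pred (MemP.∈-upTo⁻ d∈) , A∼B

  kind-of : ∀ {A} → A ∈P ℰ J → ∃[ k ] Valid k × A ∼ point k
  kind-of (here A∼P) = kP , tt , A∼P
  kind-of (there (here A∼Z)) = kE 0 , inj₁ refl , A∼Z
  kind-of (there (there (here A∼E))) = kE J , inj₂ refl , A∼E
  kind-of (there (there (there A∈))) with conic-view A∈
  ... | d , d≤J , A∼Cd = kC d , d≤J , A∼Cd

  member : ∀ k → Valid k → point k ∈P ℰ J
  member kP _ = here (∼-refl P)
  member (kE _) (inj₁ refl) = there (here (∼-refl Z))
  member (kE _) (inj₂ refl) = there (there (here (∼-refl (E J))))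
  member (kC d) d≤J = there (there (there (conic-member d≤J (∼-refl (C d)))))

  -- ℰ_J is an arc: a collinear triple of distinct points would give a collinear
  -- triple of distinct kinds, and all of these are excluded above.
  ℰ-is-arc : IsArc (ℰ J)
  ℰ-is-arc A B C A∈ B∈ C∈ A≁B A≁C B≁C col
    with kind-of A∈ | kind-of B∈ | kind-of C∈
  ... | a , va , A∼a | b , vb , B∼b | c , vc , C∼c =
    distinct-triples a b c (distinct A∼a B∼b A≁B) (distinct A∼a C∼c A≁C) (distinct B∼b C∼c B≁C) va vb vc
      (collinear-resp-∼ (∼-sym A∼a) (∼-sym B∼b) (∼-sym C∼c) col)
    where
    NonCollinear : Kind → Kind → Kind → Set
    NonCollinear a b c = Valid a → Valid b → Valid c → ¬ Collinear (point a) (point b) (point c)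

    open TripleSorting _≺_ compare NonCollinear
      (λ ¬col vb va vc → noncollinear-swap₁₂ (¬col va vb vc))
      (λ ¬col va vc vb → noncollinear-swap₂₃ (¬col va vb vc))
      (λ {a} {b} {c} → increasing-noncollinear a b c)

    distinct : ∀ {X Y x y} → X ∼ point x → Y ∼ point y → ¬ (X ∼ Y) → x ≢ y
    distinct X∼x Y∼y X≁Y refl = X≁Y (∼-trans X∼x (∼-sym Y∼y))

  module Completeness (h≤2J+1 : h ≤ suc (2 ℕ.* J)) (J̄ : ℕ) (J̄≤J : J̄ ≤ J) (covers : Covers J̄) where

    𝒬⊆ℰ : ∀ {A} → A ∈P 𝒬 J̄ → A ∈P ℰ J
    𝒬⊆ℰ (here A∼P) = here A∼P
    𝒬⊆ℰ (there (here A∼Z)) = there (here A∼Z)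
    𝒬⊆ℰ (there (there A∈)) with conic-view A∈
    ... | d , d≤J̄ , A∼Cd = there (there (there (conic-member (ℕP.≤-trans d≤J̄ J̄≤J) A∼Cd)))

    chord-through-E : ∀ {t d} k → Valid (kE t) → d ≤ J → ξ ^ (d ℕ.+ k) ≡ ξ ^ (2 ℕ.* t) → OnBisecant (C k) (ℰ J)
    chord-through-E {t} {d} k vt d≤J ξᵈ⁺ᵏ≡ξ²ᵗ = E t , C d , member (kE t) vt , member (kC d) d≤J , E≁C , (begin
      det (E t) (C d) (C k)                                      ≡⟨ det-E-C-C t d k ⟩
      (ξ ^ k + - (ξ ^ d)) * (ξ ^ d * ξ ^ k + - (ξ ^ (2 ℕ.* t)))  ≡⟨ cong (λ x → (ξ ^ k + - (ξ ^ d)) * (x + - (ξ ^ (2 ℕ.* t)))) (trans (sym (^-+ ξ d k)) ξᵈ⁺ᵏ≡ξ²ᵗ) ⟩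
      (ξ ^ k + - (ξ ^ d)) * (ξ ^ (2 ℕ.* t) + - (ξ ^ (2 ℕ.* t)))  ≡⟨ cong ((ξ ^ k + - (ξ ^ d)) *_) (-‿inverseʳ _) ⟩
      (ξ ^ k + - (ξ ^ d)) * 0#                                   ≡⟨ zeroʳ _ ⟩
      0#                                                         ∎)
      where
      E≁C : ¬ (E t ∼ C d)
      E≁C E∼C = ^-nonzero ξ≢0 d (sym (proj₁ (affine-∼ E∼C)))

    vertical-through-P : ∀ {d} k → d ≤ J → ξ ^ (2 ℕ.* d) ≡ ξ ^ (2 ℕ.* k) → OnBisecant (C k) (ℰ J)
    vertical-through-P {d} k d≤J ξ²ᵈ≡ξ²ᵏ = P , C d , member kP tt , member (kC d) d≤J ,
      (λ P∼C → affine≁infinite (∼-sym P∼C)) ,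
      trans (det-vertical _ _ _ _) (trans (cong (_+ - _) ξ²ᵈ≡ξ²ᵏ) (-‿inverseʳ _))

    conic-secant : ∀ k → J < k → k < N → OnBisecant (C k) (ℰ J)
    conic-secant k J<k k<N with conic-partner h≤2J+1 J<k k<N
    ... | d , d≤J , inj₁ d+k≡2J = chord-through-E k (inj₂ refl) d≤J (cong (ξ ^_) d+k≡2J)
    ... | d , d≤J , inj₂ (inj₂ d+k≡N) = chord-through-E k (inj₁ refl) d≤J (trans (cong (ξ ^_) d+k≡N) ξ^N≡1)
    ... | d , d≤J , inj₂ (inj₁ d+h≡k) = vertical-through-P k d≤J (begin
      ξ ^ (2 ℕ.* d)                   ≡⟨ sym (*-identityʳ _) ⟩
      ξ ^ (2 ℕ.* d) * 1#              ≡⟨ cong (_ *_) (sym ξ^N≡1) ⟩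
      ξ ^ (2 ℕ.* d) * ξ ^ N           ≡⟨ sym (^-+ ξ (2 ℕ.* d) N) ⟩
      ξ ^ (2 ℕ.* d ℕ.+ 2 ℕ.* h)       ≡⟨ cong (ξ ^_) (sym (ℕP.*-distribˡ-+ 2 d h)) ⟩
      ξ ^ (2 ℕ.* (d ℕ.+ h))           ≡⟨ cong (λ j → ξ ^ (2 ℕ.* j)) d+h≡k ⟩
      ξ ^ (2 ℕ.* k)                   ∎)

    -- Points (0, 1, b): for b ≠ 0 they are covered by 𝒬_J̄, and (0, 1, 0) = P.
    at-infinity : ∀ b → ¬ ((0# , 1# , b) ∈P ℰ J) → OnBisecant (0# , 1# , b) (ℰ J)
    at-infinity b ∉ℰ with b ≟ 0#
    ... | yes refl = ⊥-elim (∉ℰ (member kP tt))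
    ... | no b≢0 = bisecant-mono 𝒬⊆ℰ (proj₂ covers b b≢0)

    affine-point : ∀ a b → a ≢ 0# → ¬ ((1# , a , b) ∈P ℰ J) → OnBisecant (1# , a , b) (ℰ J)
    affine-point a b a≢0 ∉ℰ with b ≟ (a * a)
    ... | no b≢a² = bisecant-mono 𝒬⊆ℰ (proj₁ covers a b a≢0 b≢a²)
    ... | yes refl with discrete-log a a≢0
    ...   | k , k<N , refl with k ℕP.≤? J
    ...     | yes k≤J = ⊥-elim (∉ℰ (subst (_∈P ℰ J) (C-on-conic k) (member (kC k) k≤J)))
    ...     | no k≰J = subst (λ X → OnBisecant X (ℰ J)) (C-on-conic k) (conic-secant k (ℕP.≰⇒> k≰J) k<N)

    Z≁E : ¬ (Z ∼ E J)
    Z≁E Z∼E = E-distinct (inj₁ refl) (inj₂ refl) (ℕP.<⇒≢ 0<J) (proj₂ (affine-∼ Z∼E))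

    -- Every point off ℰ_J lies on a bisecant of ℰ_J: on the line ZE if x₁ = 0,
    -- otherwise after normalising to (0, 1, b) or (1, a, b).
    off-arc-on-bisecant : ∀ X → ¬ (X ∈P ℰ J) → OnBisecant X (ℰ J)
    off-arc-on-bisecant (u , v , w) ∉ℰ with v ≟ 0#
    ... | yes refl = Z , E J , member (kE 0) (inj₁ refl) , member (kE J) (inj₂ refl) , Z≁E , det-axis _ _ u w
    ... | no v≢0 with u ≟ 0#
    ...   | yes u≡0 = bisecant-resp-∼ X∼ (at-infinity _ (λ X'∈ → ∉ℰ (∈P-resp-∼ X∼ X'∈)))
      where X∼ = infinite-chart u≡0 v≢0
    ...   | no u≢0 = bisecant-resp-∼ X∼ (affine-point _ _ (*-nonzero v≢0 (inverse-nonzero u u≢0)) (λ X'∈ → ∉ℰ (∈P-resp-∼ X∼ X'∈)))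
      where X∼ = affine-chart u≢0

    ℰ-is-complete : IsCompleteArc (ℰ J)
    ℰ-is-complete = ℰ-is-arc , λ X _ X∉ℰ → bisecant-blocks X∉ℰ (off-arc-on-bisecant X X∉ℰ)

theorem21 : (F : FiniteField) → (ξ : FiniteField.Carrier F) →
    FiniteField.IsPrimitive F ξ →
    27 ≤ FiniteField.order F →
    FiniteField.order F % 4 ≡ 3 →
    (J̄ J : ℕ) →
    PG2.Construction.IsJq F ξ J̄ →
    J̄ ≤ (FiniteField.order F ∸ 3) / 2 →
    J̄ ≤ J →
    (FiniteField.order F ∸ 3) / 4 ≤ J →
    J ≤ (FiniteField.order F ∸ 3) / 2 →
    PG2.IsCompleteArc F (PG2.Construction.ℰ F ξ J)
theorem21 F ξ prim 27≤q q%4≡3 J̄ J isJq _ J̄≤J quarter≤J J≤half = ℰ-is-complete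
  where
  open ThreeModFour (FiniteField.order F) q%4≡3
  m≤J : m ≤ J
  m≤J = subst (_≤ J) quarter quarter≤J
  J<h : J < h
  J<h = s≤s (subst (J ≤_) half J≤half)
  0<J : 0 < J
  0<J = ℕP.<-≤-trans (m-positive (ℕP.≤-trans (s≤s (s≤s (s≤s (s≤s z≤n)))) 27≤q)) m≤J
  open ArcConstruction F ξ prim h h-odd q≡2h+1 J 0<J J<h
  open Completeness (s≤s (ℕP.*-monoʳ-≤ 2 m≤J)) J̄ J̄≤J (proj₁ isJq)
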